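{- Let $P_m$ be a path with $m\ge 2$ vertices $V_1,\dots,V_m$ labeled sequentially, let $g$ be a positive integer, and let $Q$ and $K$ be integers with $Q>K$ and $Q\ge g$. Let $\tilde D$ be a $g$-colored distribution of $Q(m-1)+2^{m-1}Q$ pebbles on $P_m$ such that $|V_i|\ge Q$ for all $i>1$ and $|V_1|=K$. Then there exists a sequence of color-respecting pebbling steps at the end of which $|V_i|\ge Q$ for all $1\le i\le m$.
   Context: $|V_i|$ denotes the number of pebbles on vertex $V_i$. A $g$-colored distribution is a placement of pebbles on the vertices in which each pebble is assigned one of $g$ colors. A color-respecting pebbling step removes two pebbles of the same color from a vertex and places one pebble of that color on an adjacent vertex. -}

module Defs where

open import Data.Nat using (ℕ; zero; suc; _+_; _∸_; _≤_)
open import Data.Fin using (Fin; toℕ; _≟_)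
open import Data.Product using (Σ; _×_; ∃-syntax)
open import Data.Sum using (_⊎_)
open import Relation.Binary.PropositionalEquality using (_≡_)
open import Relation.Nullary using (yes; no)
open import Relation.Binary.Construct.Closure.ReflexiveTransitive using (Star)

sumFin : ∀ n → (Fin n → ℕ) → ℕ
sumFin zero    f = 0
sumFin (suc n) f = f Fin.zero + sumFin n (λ i → f (Fin.suc i))

-- A g-colored distribution on the path P_m: D v c = number of pebbles of
-- color c on vertex v.  Vertex V_i of the paper is the index i-1 : Fin m.
Distribution : ℕ → ℕ → Set
Distribution m g = Fin m → Fin g → ℕ

∣_at_∣ : ∀ {m g} → Distribution m g → Fin m → ℕ
∣_at_∣ {g = g} D v = sumFin g (D v)

total : ∀ {m g} → Distribution m g → ℕ
total {m} D = sumFin m (λ v → ∣ D at v ∣)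

PathAdj : ∀ {m} → Fin m → Fin m → Set
PathAdj v w = (toℕ w ≡ suc (toℕ v)) ⊎ (toℕ v ≡ suc (toℕ w))

move : ∀ {m g} → Distribution m g → Fin m → Fin m → Fin g → Distribution m g
move D v w c x d with x ≟ v | x ≟ w | d ≟ c
... | yes _ | _     | yes _ = D x d ∸ 2
... | no _  | yes _ | yes _ = D x d + 1
... | _     | _     | _     = D x d

data Step {m g : ℕ} : Distribution m g → Distribution m g → Set where
  step : ∀ {D} (v w : Fin m) (c : Fin g) →
         PathAdj v w → 2 ≤ D v c → Step D (move D v w c)

Reachable : ∀ {m g} → Distribution m g → Distribution m g → Set
Reachable = Star Step

-- Sweep the surplus above Q towards V₁, starting at V_m: at each vertex, move
-- half of the surplus it holds one step to the left.  The surplus arriving at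
-- a vertex, doubled once for every vertex to its right, exceeds the original
-- surplus of that vertex and everything to its right.  At V₂ the original
-- surplus of V₂,…,V_m is 2^(m-1)·Q − K, so at least 2(Q − K) pebbles of surplus
-- arrive at V₂, enough to send Q − K pebbles to V₁.  Colours enter only
-- through pigeonhole: g + 2 pebbles on a vertex include two of the same
-- colour, so moving t pebbles off a vertex needs g + 2t of them there, and
-- Q ≥ g guarantees this whenever the surplus is large enough.
module Submission where

open import Defs
open import Data.Nat using (ℕ; zero; suc; _+_; _*_; _^_; _∸_; _≤_; _<_; z≤n; s≤s; z<s; _≤?_; ⌊_/2⌋)
open import Data.Nat.Properties hiding (_≟_)
open import Data.Nat.Tactic.RingSolver using (solve-∀)
open import Data.Fin using (Fin; toℕ; _≟_; fromℕ<)
open import Data.Fin.Properties using (toℕ-injective; toℕ-fromℕ<; toℕ<n) renaming (suc-injective to suc-injectiveᶠ)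
open import Data.Product using (_×_; ∃-syntax; _,_)
open import Data.Sum using (inj₁; inj₂)
open import Function using (_∘_)
open import Relation.Nullary using (yes; no; contradiction)
open import Relation.Binary.PropositionalEquality
open import Relation.Binary.Construct.Closure.ReflexiveTransitive using (ε; _◅_; _◅◅_)

open Fin

sumFin-cong : ∀ n {f f′ : Fin n → ℕ} → (∀ x → f x ≡ f′ x) → sumFin n f ≡ sumFin n f′
sumFin-cong zero    f≗f′ = refl
sumFin-cong (suc n) f≗f′ = cong₂ _+_ (f≗f′ zero) (sumFin-cong n (f≗f′ ∘ suc))

sumFin-zero : ∀ n → sumFin n (λ _ → 0) ≡ 0
sumFin-zero zero    = refl
sumFin-zero (suc n) = sumFin-zero n

sumFin-agreeExcept : ∀ n (f f′ : Fin n → ℕ) a → (∀ x → x ≢ a → f′ x ≡ f x) →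
  sumFin n f′ + f a ≡ sumFin n f + f′ a
sumFin-agreeExcept (suc n) f f′ zero agree =
  trans (cong (λ s → f′ zero + s + f zero) (sumFin-cong n (λ x → agree (suc x) λ ())))
        (swap (f′ zero) _ (f zero))
  where
  swap : ∀ a b c → a + b + c ≡ c + b + a
  swap = solve-∀
sumFin-agreeExcept (suc n) f f′ (suc a) agree =
  trans (+-assoc (f′ zero) _ _)
    (trans (cong₂ _+_ (agree zero λ ())
                      (sumFin-agreeExcept n (f ∘ suc) (f′ ∘ suc) a
                         (λ x x≢a → agree (suc x) (x≢a ∘ suc-injectiveᶠ))))
           (sym (+-assoc (f zero) _ _)))

pigeonhole-pair : ∀ n (f : Fin n → ℕ) → n < sumFin n f → ∃[ d ] 2 ≤ f d
pigeonhole-pair (suc n) f n<Σ with 2 ≤? f zero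
... | yes 2≤f0 = zero , 2≤f0
... | no 2≰f0 with pigeonhole-pair n (f ∘ suc) (≤-pred (≤-trans n<Σ f0+Σ≤1+Σ))
  where
  f0+Σ≤1+Σ : f zero + sumFin n (f ∘ suc) ≤ 1 + sumFin n (f ∘ suc)
  f0+Σ≤1+Σ = +-monoˡ-≤ _ (≤-pred (≰⇒> 2≰f0))
... | d , 2≤fd = suc d , 2≤fd

toℕ-<⇒≢ : ∀ {n} {i j : Fin n} → toℕ i < toℕ j → i ≢ j
toℕ-<⇒≢ i<j = <⇒≢ i<j ∘ cong toℕ

PathAdj⇒≢ : ∀ {m} {v w : Fin m} → PathAdj v w → w ≢ v
PathAdj⇒≢ (inj₁ w≡1+v) refl = 1+n≢n (sym w≡1+v)
PathAdj⇒≢ (inj₂ v≡1+w) refl = 1+n≢n (sym v≡1+w)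

module _ {m g} (D : Distribution m g) (v w : Fin m) (c : Fin g) where

  move-source : move D v w c v c ≡ D v c ∸ 2
  move-source with v ≟ v | c ≟ c
  ... | yes _   | yes _ = refl
  ... | no v≢v  | _     = contradiction refl v≢v
  ... | yes _   | no c≢c = contradiction refl c≢c

  move-source-other : ∀ {d} → d ≢ c → move D v w c v d ≡ D v d
  move-source-other {d} d≢c with v ≟ v | v ≟ w | d ≟ c
  ... | _      | _ | yes d≡c = contradiction d≡c d≢c
  ... | yes _  | _ | no _    = refl
  ... | no v≢v | _ | no _    = contradiction refl v≢v

  move-target : w ≢ v → move D v w c w c ≡ D w c + 1
  move-target w≢v with w ≟ v | w ≟ w | c ≟ c
  ... | yes w≡v | _      | _      = contradiction w≡v w≢v
  ... | no _    | yes _  | yes _  = refl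
  ... | no _    | no w≢w | _      = contradiction refl w≢w
  ... | no _    | yes _  | no c≢c = contradiction refl c≢c

  move-target-other : ∀ {d} → d ≢ c → move D v w c w d ≡ D w d
  move-target-other {d} d≢c with w ≟ v | w ≟ w | d ≟ c
  ... | _     | _     | yes d≡c = contradiction d≡c d≢c
  ... | yes _ | _     | no _    = refl
  ... | no _  | yes _ | no _    = refl
  ... | no _  | no _  | no _    = refl

  move-elsewhere : ∀ {x} d → x ≢ v → x ≢ w → move D v w c x d ≡ D x d
  move-elsewhere {x} d x≢v x≢w with x ≟ v | x ≟ w | d ≟ c
  ... | yes x≡v | _       | _     = contradiction x≡v x≢v
  ... | no _    | yes x≡w | _     = contradiction x≡w x≢w
  ... | no _    | no _    | yes _ = refl
  ... | no _    | no _    | no _  = refl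

  ∣move∣-source : 2 ≤ D v c → ∣ move D v w c at v ∣ + 2 ≡ ∣ D at v ∣
  ∣move∣-source 2≤Dvc = +-cancelʳ-≡ (D v c ∸ 2) _ _ (begin
    ∣ move D v w c at v ∣ + 2 + (D v c ∸ 2)   ≡⟨ +-assoc _ 2 _ ⟩
    ∣ move D v w c at v ∣ + (2 + (D v c ∸ 2)) ≡⟨ cong (∣ move D v w c at v ∣ +_) (m+[n∸m]≡n 2≤Dvc) ⟩
    ∣ move D v w c at v ∣ + D v c             ≡⟨ sumFin-agreeExcept g (D v) (move D v w c v) c (λ _ → move-source-other) ⟩
    ∣ D at v ∣ + move D v w c v c             ≡⟨ cong (∣ D at v ∣ +_) move-source ⟩
    ∣ D at v ∣ + (D v c ∸ 2)                  ∎)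
    where open ≡-Reasoning

  ∣move∣-target : w ≢ v → ∣ move D v w c at w ∣ ≡ ∣ D at w ∣ + 1
  ∣move∣-target w≢v = +-cancelʳ-≡ (D w c) _ _ (begin
    ∣ move D v w c at w ∣ + D w c ≡⟨ sumFin-agreeExcept g (D w) (move D v w c w) c (λ _ → move-target-other) ⟩
    ∣ D at w ∣ + move D v w c w c ≡⟨ cong (∣ D at w ∣ +_) (trans (move-target w≢v) (+-comm (D w c) 1)) ⟩
    ∣ D at w ∣ + (1 + D w c)      ≡⟨ +-assoc (∣ D at w ∣) 1 (D w c) ⟨
    ∣ D at w ∣ + 1 + D w c        ∎)
    where open ≡-Reasoning

  ∣move∣-elsewhere : ∀ {x} → x ≢ v → x ≢ w → ∣ move D v w c at x ∣ ≡ ∣ D at x ∣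
  ∣move∣-elsewhere x≢v x≢w = sumFin-cong g (λ d → move-elsewhere d x≢v x≢w)

record Transfer {m g} (D : Distribution m g) (v w : Fin m) (t : ℕ) : Set where
  field
    after     : Distribution m g
    steps     : Reachable D after
    source    : ∣ after at v ∣ + 2 * t ≡ ∣ D at v ∣
    target    : ∣ after at w ∣ ≡ ∣ D at w ∣ + t
    elsewhere : ∀ x → x ≢ v → x ≢ w → ∣ after at x ∣ ≡ ∣ D at x ∣

transfer : ∀ {m g} t (D : Distribution m g) {v w : Fin m} → PathAdj v w →
  g + 2 * t ≤ ∣ D at v ∣ → Transfer D v w t
transfer zero D adj _ = record
  { after = D ; steps = ε ; source = +-identityʳ _ ; target = sym (+-identityʳ _)
  ; elsewhere = λ _ _ _ → refl }
transfer {g = g} (suc t) D {v} {w} adj room with pigeonhole-pair g (D v) (<-≤-trans (m<m+n g z<s) room)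
... | c , 2≤Dvc = record
  { after     = T.after
  ; steps     = step v w c adj 2≤Dvc ◅ T.steps
  ; source    = trans (two-more ∣ T.after at v ∣ t) (trans (cong (_+ 2) T.source) (∣move∣-source D v w c 2≤Dvc))
  ; target    = trans T.target (trans (cong (_+ t) (∣move∣-target D v w c (PathAdj⇒≢ adj))) (+-assoc _ 1 t))
  ; elsewhere = λ x x≢v x≢w → trans (T.elsewhere x x≢v x≢w) (∣move∣-elsewhere D v w c x≢v x≢w)
  }
  where
  two-more : ∀ a t → a + 2 * suc t ≡ a + 2 * t + 2
  two-more = solve-∀
  room′ : g + 2 * t ≤ ∣ move D v w c at v ∣
  room′ = +-cancelʳ-≤ 2 _ _
    (subst₂ _≤_ (two-more g t) (sym (∣move∣-source D v w c 2≤Dvc)) room)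
  module T = Transfer (transfer t (move D v w c) adj room′)

keepFrom : ℕ → ℕ → ℕ → ℕ
keepFrom zero    i       x = x
keepFrom (suc j) zero    x = 0
keepFrom (suc j) (suc i) x = keepFrom j i x

keepFrom-refl : ∀ j x → keepFrom j j x ≡ x
keepFrom-refl zero    x = refl
keepFrom-refl (suc j) x = keepFrom-refl j x

keepFrom-< : ∀ {j i} x → i < j → keepFrom j i x ≡ 0
keepFrom-< {suc j} {zero}  x _         = refl
keepFrom-< {suc j} {suc i} x (s≤s i<j) = keepFrom-< x i<j

keepFrom-suc : ∀ {j i} x → i ≢ j → keepFrom (suc j) i x ≡ keepFrom j i x
keepFrom-suc {zero}  {zero}  x i≢j = contradiction refl i≢j
keepFrom-suc {zero}  {suc i} x _   = refl
keepFrom-suc {suc j} {zero}  x _   = refl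
keepFrom-suc {suc j} {suc i} x i≢j = keepFrom-suc x (i≢j ∘ cong suc)

suffixSum : ∀ {m g} → ℕ → Distribution m g → ℕ
suffixSum {m} j D = sumFin m (λ i → keepFrom j (toℕ i) ∣ D at i ∣)

module _ {m g} (D : Distribution m g) where

  suffixSum-split : ∀ a → suffixSum (toℕ a) D ≡ ∣ D at a ∣ + suffixSum (suc (toℕ a)) D
  suffixSum-split a = begin
    suffixSum j D                       ≡⟨ +-identityʳ _ ⟨
    suffixSum j D + 0                   ≡⟨ cong (suffixSum j D +_) (keepFrom-< ∣ D at a ∣ (n<1+n j)) ⟨
    suffixSum j D + keepFrom (suc j) j ∣ D at a ∣
      ≡⟨ sumFin-agreeExcept m (λ i → keepFrom j (toℕ i) ∣ D at i ∣) (λ i → keepFrom (suc j) (toℕ i) ∣ D at i ∣) a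
           (λ x x≢a → keepFrom-suc ∣ D at x ∣ (x≢a ∘ toℕ-injective)) ⟨
    suffixSum (suc j) D + keepFrom j j ∣ D at a ∣ ≡⟨ cong (suffixSum (suc j) D +_) (keepFrom-refl j _) ⟩
    suffixSum (suc j) D + ∣ D at a ∣    ≡⟨ +-comm _ ∣ D at a ∣ ⟩
    ∣ D at a ∣ + suffixSum (suc j) D    ∎
    where
    open ≡-Reasoning
    j = toℕ a

  suffixSum-beyond : ∀ {j} → m ≤ j → suffixSum j D ≡ 0
  suffixSum-beyond m≤j = trans (sumFin-cong m (λ i → keepFrom-< _ (<-≤-trans (toℕ<n i) m≤j))) (sumFin-zero m)

2*⌊n/2⌋≤n : ∀ n → 2 * ⌊ n /2⌋ ≤ n
2*⌊n/2⌋≤n zero          = z≤n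
2*⌊n/2⌋≤n (suc zero)    = z≤n
2*⌊n/2⌋≤n (suc (suc n)) rewrite *-suc 2 ⌊ n /2⌋ = s≤s (s≤s (2*⌊n/2⌋≤n n))

n≤1+2*⌊n/2⌋ : ∀ n → n ≤ suc (2 * ⌊ n /2⌋)
n≤1+2*⌊n/2⌋ zero          = z≤n
n≤1+2*⌊n/2⌋ (suc zero)    = s≤s z≤n
n≤1+2*⌊n/2⌋ (suc (suc n)) rewrite *-suc 2 ⌊ n /2⌋ = s≤s (s≤s (n≤1+2*⌊n/2⌋ n))

m≤2*n*m : ∀ {n} m → 1 ≤ n → m ≤ 2 * n * m
m≤2*n*m {n} m 1≤n = subst (_≤ 2 * n * m) (*-identityˡ m) (*-monoˡ-≤ m (≤-trans 1≤n (m≤m+n n (n + 0))))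

m+n≡o+p∧n≤p⇒o≤m : ∀ {m n o p} → m + n ≡ o + p → n ≤ p → o ≤ m
m+n≡o+p∧n≤p⇒o≤m {m} {n} {o} m+n≡o+p n≤p =
  +-cancelʳ-≤ n o m (subst (o + n ≤_) (sym m+n≡o+p) (+-monoʳ-≤ o n≤p))

surplus-step : ∀ P {Q L e₀ e₁ f S} → 1 ≤ P → e₁ ≤ suc (2 * f) → S < P * suc e₁ + L →
  Q + e₀ + S < 2 * P * suc (e₀ + f) + (Q + L)
surplus-step P {Q} {L} {e₀} {e₁} {f} {S} 1≤P e₁≤1+2f S< = begin-strict
  Q + e₀ + S                               <⟨ +-monoʳ-< (Q + e₀) S< ⟩
  Q + e₀ + (P * suc e₁ + L)                ≤⟨ +-mono-≤ (+-monoʳ-≤ Q (m≤2*n*m e₀ 1≤P))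
                                                       (+-monoˡ-≤ L (*-monoʳ-≤ P 1+e₁≤2+2f)) ⟩
  Q + 2 * P * e₀ + (P * (2 * suc f) + L)   ≡⟨ normalise P Q L e₀ f ⟩
  2 * P * suc (e₀ + f) + (Q + L)           ∎
  where
  open ≤-Reasoning
  1+e₁≤2+2f : suc e₁ ≤ 2 * suc f
  1+e₁≤2+2f = subst (suc e₁ ≤_) (sym (*-suc 2 f)) (s≤s e₁≤1+2f)
  normalise : ∀ P Q L e₀ f → Q + 2 * P * e₀ + (P * (2 * suc f) + L) ≡ 2 * P * suc (e₀ + f) + (Q + L)
  normalise = solve-∀

deficit-covered : ∀ P n {K Q e S} → 1 ≤ P → K ≤ Q → K + S ≡ Q * n + 2 * P * Q →
  S < P * suc e + n * Q → 2 * (Q ∸ K) ≤ e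
deficit-covered P n {K} {Q} {e} {S} 1≤P K≤Q total S< with Q ∸ K | m+[n∸m]≡n K≤Q
... | t | refl with 2 * t ≤? e
... | yes 2t≤e = 2t≤e
... | no 2t≰e = contradiction total (<⇒≢ (begin-strict
  K + S                              <⟨ +-monoʳ-< K S< ⟩
  K + (P * suc e + n * (K + t))      ≤⟨ +-mono-≤ (m≤2*n*m K 1≤P) (+-monoˡ-≤ (n * (K + t)) (*-monoʳ-≤ P (≰⇒> 2t≰e))) ⟩
  2 * P * K + (P * (2 * t) + n * (K + t)) ≡⟨ normalise P n K t ⟩
  (K + t) * n + 2 * P * (K + t)      ∎))
  where
  open ≤-Reasoning
  normalise : ∀ P n K t → 2 * P * K + (P * (2 * t) + n * (K + t)) ≡ (K + t) * n + 2 * P * (K + t)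
  normalise = solve-∀

module Sweep {m g} (Q : ℕ) (g≤Q : g ≤ Q) (D : Distribution m g)
             (full : ∀ i → 1 ≤ toℕ i → Q ≤ ∣ D at i ∣) where

  record Swept (k : ℕ) (a : Fin m) : Set where
    field
      result          : Distribution m g
      reachable       : Reachable D result
      unchanged-below : ∀ i → toℕ i < toℕ a → ∣ result at i ∣ ≡ ∣ D at i ∣
      full-from       : ∀ i → toℕ a ≤ toℕ i → Q ≤ ∣ result at i ∣
      surplus         : ℕ
      at-a            : ∣ result at a ∣ ≡ Q + surplus
      bound           : suffixSum (toℕ a) D < 2 ^ k * suc surplus + suc k * Q

  sweep-last : ∀ a → 1 ≤ toℕ a → suc (toℕ a) ≡ m → Swept 0 a
  sweep-last a 1≤a a+1≡m = record
    { result = D ; reachable = ε ; unchanged-below = λ _ _ → refl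
    ; full-from = λ i a≤i → full i (≤-trans 1≤a a≤i)
    ; surplus = e ; at-a = sym Q+e≡Da ; bound = subst (_< 1 * suc e + 1 * Q) (sym suffix≡Q+e) Q+e<1+e+Q }
    where
    e = ∣ D at a ∣ ∸ Q
    Q+e≡Da : Q + e ≡ ∣ D at a ∣
    Q+e≡Da = m+[n∸m]≡n (full a 1≤a)
    suffix≡Q+e : suffixSum (toℕ a) D ≡ Q + e
    suffix≡Q+e = trans (suffixSum-split D a)
      (trans (cong (∣ D at a ∣ +_) (suffixSum-beyond D (≤-reflexive (sym a+1≡m))))
             (trans (+-identityʳ _) (sym Q+e≡Da)))
    Q+e<1+e+Q : Q + e < 1 * suc e + 1 * Q
    Q+e<1+e+Q = subst (Q + e <_) (normalise Q e) (n<1+n (Q + e))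
      where
      normalise : ∀ Q e → suc (Q + e) ≡ 1 * suc e + 1 * Q
      normalise = solve-∀

  sweep-step : ∀ {k} {a a′ : Fin m} → 1 ≤ toℕ a → toℕ a′ ≡ suc (toℕ a) → Swept k a′ → Swept (suc k) a
  sweep-step {k} {a} {a′} 1≤a a′≡1+a r = record
    { result = T.after ; reachable = R.reachable ◅◅ T.steps ; unchanged-below = unchanged-below
    ; full-from = full-from ; surplus = e₀ + f ; at-a = at-a ; bound = bound }
    where
    module R = Swept r
    f = ⌊ R.surplus /2⌋
    e₀ = ∣ D at a ∣ ∸ Q
    Q+e₀≡Da : Q + e₀ ≡ ∣ D at a ∣
    Q+e₀≡Da = m+[n∸m]≡n (full a 1≤a)
    room : g + 2 * f ≤ ∣ R.result at a′ ∣
    room = subst (g + 2 * f ≤_) (sym R.at-a) (+-mono-≤ g≤Q (2*⌊n/2⌋≤n R.surplus))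
    module T = Transfer (transfer f R.result (inj₂ a′≡1+a) room)
    a<a′ : toℕ a < toℕ a′
    a<a′ = ≤-reflexive (sym a′≡1+a)
    at-a : ∣ T.after at a ∣ ≡ Q + (e₀ + f)
    at-a = trans T.target (trans (cong (_+ f) (trans (R.unchanged-below a a<a′) (sym Q+e₀≡Da))) (+-assoc Q e₀ f))
    unchanged-below : ∀ i → toℕ i < toℕ a → ∣ T.after at i ∣ ≡ ∣ D at i ∣
    unchanged-below i i<a = trans (T.elsewhere i (toℕ-<⇒≢ (<-trans i<a a<a′)) (toℕ-<⇒≢ i<a))
                                  (R.unchanged-below i (<-trans i<a a<a′))
    full-from : ∀ i → toℕ a ≤ toℕ i → Q ≤ ∣ T.after at i ∣
    full-from i a≤i with m≤n⇒m<n∨m≡n a≤i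
    ... | inj₂ a≡i = subst (λ x → Q ≤ ∣ T.after at x ∣) (toℕ-injective a≡i) (subst (Q ≤_) (sym at-a) (m≤m+n Q _))
    ... | inj₁ a<i with m≤n⇒m<n∨m≡n (subst (_≤ toℕ i) (sym a′≡1+a) a<i)
    ...   | inj₂ a′≡i = subst (λ x → Q ≤ ∣ T.after at x ∣) (toℕ-injective a′≡i)
                          (m+n≡o+p∧n≤p⇒o≤m (trans T.source R.at-a) (2*⌊n/2⌋≤n R.surplus))
    ...   | inj₁ a′<i = subst (Q ≤_) (sym (T.elsewhere i (toℕ-<⇒≢ a′<i ∘ sym) (toℕ-<⇒≢ a<i ∘ sym)))
                          (R.full-from i (<⇒≤ a′<i))
    bound : suffixSum (toℕ a) D < 2 ^ suc k * suc (e₀ + f) + suc (suc k) * Q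
    bound = subst (_< 2 ^ suc k * suc (e₀ + f) + suc (suc k) * Q)
      (sym (trans (suffixSum-split D a) (cong₂ _+_ (sym Q+e₀≡Da) (cong (λ j → suffixSum j D) (sym a′≡1+a)))))
      (surplus-step (2 ^ k) {Q = Q} {e₀ = e₀} {f = f} (m^n>0 2 k) (n≤1+2*⌊n/2⌋ R.surplus) R.bound)

  sweep : ∀ k (a : Fin m) → 1 ≤ toℕ a → toℕ a + suc k ≡ m → Swept k a
  sweep zero    a 1≤a a+1≡m = sweep-last a 1≤a (trans (+-comm 1 (toℕ a)) a+1≡m)
  sweep (suc k) a 1≤a a+2+k≡m =
    sweep-step 1≤a a′≡1+a (sweep k a′ (subst (1 ≤_) (sym a′≡1+a) (s≤s z≤n)) a′+1+k≡m)
    where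
    1+a<m : suc (toℕ a) < m
    1+a<m = subst (suc (toℕ a) <_) a+2+k≡m
              (subst (_≤ toℕ a + suc (suc k)) (+-comm (toℕ a) 2) (+-monoʳ-≤ (toℕ a) (s≤s (s≤s z≤n))))
    a′ : Fin m
    a′ = fromℕ< 1+a<m
    a′≡1+a : toℕ a′ ≡ suc (toℕ a)
    a′≡1+a = toℕ-fromℕ< 1+a<m
    a′+1+k≡m : toℕ a′ + suc k ≡ m
    a′+1+k≡m = trans (cong (_+ suc k) a′≡1+a) (trans (sym (+-suc (toℕ a) (suc k))) a+2+k≡m)


proposition2p3 : (m g Q K : ℕ) → 2 ≤ m → 1 ≤ g → K < Q → g ≤ Q →
    (D : Distribution m g) →
    total D ≡ Q * (m ∸ 1) + 2 ^ (m ∸ 1) * Q →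
    (∀ (i : Fin m) → 1 ≤ toℕ i → Q ≤ ∣ D at i ∣) →
    (∀ (i : Fin m) → toℕ i ≡ 0 → ∣ D at i ∣ ≡ K) →
    ∃[ D′ ] (Reachable D D′ × (∀ (i : Fin m) → Q ≤ ∣ D′ at i ∣))
proposition2p3 (suc zero) _ _ _ (s≤s ()) _ _ _ _ _ _ _
proposition2p3 (suc (suc n)) g Q K _ _ K<Q g≤Q D total≡ full V₁≡K =
  T.after , S.reachable ◅◅ T.steps , full-after
  where
  module S = Sweep.Swept (Sweep.sweep Q g≤Q D full n (suc zero) (s≤s z≤n) refl)
  2[Q∸K]≤e : 2 * (Q ∸ K) ≤ S.surplus
  2[Q∸K]≤e = deficit-covered (2 ^ n) (suc n) (m^n>0 2 n) (<⇒≤ K<Q)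
    (trans (cong (_+ _) (sym (V₁≡K zero refl))) (trans (sym (suffixSum-split D zero)) total≡)) S.bound
  room : g + 2 * (Q ∸ K) ≤ ∣ S.result at suc zero ∣
  room = subst (g + 2 * (Q ∸ K) ≤_) (sym S.at-a) (+-mono-≤ g≤Q 2[Q∸K]≤e)
  module T = Transfer (transfer (Q ∸ K) S.result (inj₂ refl) room)
  full-after : ∀ i → Q ≤ ∣ T.after at i ∣
  full-after zero = ≤-reflexive (sym (trans T.target (trans (cong (_+ (Q ∸ K)) V₁-unchanged) (m+[n∸m]≡n (<⇒≤ K<Q)))))
    where
    V₁-unchanged : ∣ S.result at zero ∣ ≡ K
    V₁-unchanged = trans (S.unchanged-below zero (s≤s z≤n)) (V₁≡K zero refl)
  full-after (suc zero)    = m+n≡o+p∧n≤p⇒o≤m (trans T.source S.at-a) 2[Q∸K]≤e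
  full-after (suc (suc i)) = subst (Q ≤_) (sym (T.elsewhere _ (λ ()) (λ ()))) (S.full-from _ (s≤s z≤n))
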